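{- Let $A$ and $B$ be two asynchronously composable IOTSes that are weakly asynchronously compatible. If the asynchronous system $A\otimes_{as}B$ is half-duplex, then $A\otimes B$ is synchronously deadlock-free if and only if $A\otimes_{as}B$ is asynchronously deadlock-free.
   Context: An IOTS $A=(\mathit{states}_A,\mathit{start}_A,\mathit{act}_A,\to_A)$ has states, initial state, actions $\mathit{act}_A=\mathit{in}_A\cup\mathit{out}_A\cup\mathit{int}_A$ (disjoint union of inputs, outputs, internal actions) and transitions $s\xrightarrow{a}_A s'$. $s\ (\xrightarrow{X})^*_A\ s'$ denotes a possibly empty finite sequence of transitions labelled in $X$; $\mathit{reach}(A)$ is the set of states reachable from $\mathit{start}_A$. $A,B$ are composable if $\mathit{act}_A\cap\mathit{act}_B=(\mathit{in}_A\cap\mathit{out}_B)\cup(\mathit{in}_B\cap\mathit{out}_A)=:\mathit{shared}(A,B)$. Synchronous composition $A\otimes B$: states $\mathit{states}_A\times\mathit{states}_B$, initial $(\mathit{start}_A,\mathit{start}_B)$, inputs $(\mathit{in}_A\cup\mathit{in}_B)\setminus\mathit{shared}(A,B)$, outputs $(\mathit{out}_A\cup\mathit{out}_B)\setminus\mathit{shared}(A,B)$, internal $\mathit{int}_A\cup\mathit{int}_B\cup\mathit{shared}(A,B)$; a non-shared action of one component moves only that component; a shared action $a$ yields $(s,t)\xrightarrow{a}(s',t')$ when $s\xrightarrow{a}_A s'$ and $t\xrightarrow{a}_B t'$. For a set $M$, $M^\rhd=\{a^\rhd\mid a\in M\}$ are fresh names. $A,B$ are asynchronously composable if composable and $\mathit{shared}(A,B)^\rhd\cap(\mathit{act}_A\cup\mathit{act}_B)=\emptyset$.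 With $\mathit{out}_{AB}=\mathit{out}_A\cap\mathit{in}_B$, $\Omega(A)$ is the IOTS with states $(s,q)$, $s\in\mathit{states}_A$, $q\in\mathit{out}_{AB}^*$, initial $(\mathit{start}_A,\epsilon)$, inputs $\mathit{in}_A$, outputs $\mathit{out}_A$, internal actions $\mathit{int}_A\cup\mathit{out}_{AB}^\rhd$, transitions $(s,q)\xrightarrow{a}(s',q)$ if $s\xrightarrow{a}_A s'$, $a\notin\mathit{out}_{AB}$; $(s,q)\xrightarrow{a^\rhd}(s',qa)$ if $s\xrightarrow{a}_A s'$, $a\in\mathit{out}_{AB}$; $(s,aq)\xrightarrow{a}(s,q)$ for $a\in\mathit{out}_{AB}$. $\Omega(B)$ analogously with $\mathit{out}_{BA}=\mathit{out}_B\cap\mathit{in}_A$. $A\otimes_{as}B=\Omega(A)\otimes\Omega(B)$; it is half-duplex if every reachable state $((s_A,q_A),(s_B,q_B))$ has $q_A=\epsilon$ or $q_B=\epsilon$. IOTSes $C,D$ are weakly synchronously compatible if composable and for all $(s_C,s_D)\in\mathit{reach}(C\otimes D)$ and $a\in\mathit{out}_C\cap\mathit{in}_D$ with $s_C\xrightarrow{a}_C s_C'$ there exist $\bar s_D,s_D'$ with $s_D\ (\xrightarrow{\mathit{int}_D})^*_D\ \bar s_D\xrightarrow{a}_D s_D'$, and symmetrically. $A,B$ are weakly asynchronously compatible if $\Omega(A)$ and $\Omega(B)$ are weakly synchronously compatible. A deadlock state of $A\otimes B$ is a reachable state of $A\otimes B$ with no outgoing transition; $A\otimes B$ is synchronously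 deadlock-free if it has no deadlock state. A deadlock state of $A\otimes_{as}B$ is a reachable state of $\Omega(A)\otimes\Omega(B)$ with no outgoing transition; $A\otimes_{as}B$ is asynchronously deadlock-free if it has none. -}

module Defs where

open import Data.Product using (Σ; ∃; ∃-syntax; _×_; _,_; proj₁; proj₂)
open import Data.Sum using (_⊎_; inj₁; inj₂)
open import Data.Empty using (⊥)
open import Data.List using (List; []; _∷_; _++_; [_])
open import Relation.Nullary using (¬_)
open import Relation.Binary.PropositionalEquality using (_≡_)

record IOTS (X : Set) : Set₁ where
  field
    states : Set
    start  : states
    inp    : X → Set
    out    : X → Set
    int    : X → Set
    _⟶[_]_ : states → X → states → Set

open IOTS public

act : ∀ {X} → IOTS X → X → Set
act A a = inp A a ⊎ out A a ⊎ int A a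

record IsIOTS {X : Set} (A : IOTS X) : Set where
  field
    in-out  : ∀ a → inp A a → out A a → ⊥
    in-int  : ∀ a → inp A a → int A a → ⊥
    out-int : ∀ a → out A a → int A a → ⊥
    labels  : ∀ {s a s'} → _⟶[_]_ A s a s' → act A a

shared : ∀ {X} → IOTS X → IOTS X → X → Set
shared A B a = (inp A a × out B a) ⊎ (inp B a × out A a)

-- act_A ∩ act_B = shared(A,B)  (the inclusion ⊇ holds by definition)
Composable : ∀ {X} → IOTS X → IOTS X → Set
Composable A B = ∀ a → act A a → act B a → shared A B a

data SyncStep {X : Set} (A B : IOTS X)
     : states A × states B → X → states A × states B → Set where
  stepA : ∀ {s s' t a} → _⟶[_]_ A s a s' → ¬ shared A B a →
          SyncStep A B (s , t) a (s' , t)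
  stepB : ∀ {s t t' a} → _⟶[_]_ B t a t' → ¬ shared A B a →
          SyncStep A B (s , t) a (s , t')
  stepAB : ∀ {s s' t t' a} → shared A B a → _⟶[_]_ A s a s' → _⟶[_]_ B t a t' →
           SyncStep A B (s , t) a (s' , t')

_⊗_ : ∀ {X} → IOTS X → IOTS X → IOTS X
A ⊗ B = record
  { states = states A × states B
  ; start  = (start A , start B)
  ; inp    = λ a → (inp A a ⊎ inp B a) × ¬ shared A B a
  ; out    = λ a → (out A a ⊎ out B a) × ¬ shared A B a
  ; int    = λ a → int A a ⊎ int B a ⊎ shared A B a
  ; _⟶[_]_ = SyncStep A B
  }

data Reach {X : Set} (A : IOTS X) : states A → Set where
  reach-start : Reach A (start A)
  reach-step  : ∀ {s a s'} → Reach A s → _⟶[_]_ A s a s' → Reach A s'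

data IntStar {X : Set} (A : IOTS X) : states A → states A → Set where
  int-refl : ∀ {s} → IntStar A s s
  int-step : ∀ {s a s' s''} → int A a → _⟶[_]_ A s a s' → IntStar A s' s'' →
             IntStar A s s''

DeadlockState : ∀ {X} (A : IOTS X) → states A → Set
DeadlockState A s = Reach A s × (∀ a s' → ¬ (_⟶[_]_ A s a s'))

DeadlockFree : ∀ {X} → IOTS X → Set
DeadlockFree A = ∀ s → ¬ DeadlockState A s

-- The fresh names a^▷ are modelled by tagging: actions of Ω(A) live in
-- X ⊎ X, where inj₁ a is the original action a and inj₂ a is a^▷.
-- This makes  shared(A,B)^▷ ∩ (act_A ∪ act_B) = ∅  hold by construction.

outTo : ∀ {X} → IOTS X → IOTS X → X → Set
outTo A B a = out A a × inp B a

data ΩStep {X : Set} (A B : IOTS X)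
     : states A × List (Σ X (outTo A B)) → X ⊎ X →
       states A × List (Σ X (outTo A B)) → Set where
  loc  : ∀ {s s' q a} → _⟶[_]_ A s a s' → ¬ outTo A B a →
         ΩStep A B (s , q) (inj₁ a) (s' , q)
  enq  : ∀ {s s' q a} → _⟶[_]_ A s a s' → (p : outTo A B a) →
         ΩStep A B (s , q) (inj₂ a) (s' , q ++ [ (a , p) ])
  deq  : ∀ {s q a} (p : outTo A B a) →
         ΩStep A B (s , (a , p) ∷ q) (inj₁ a) (s , q)

-- Ω(A) with respect to partner B  (Ω(B) is  Ω B A)
Ω : ∀ {X} → IOTS X → IOTS X → IOTS (X ⊎ X)
Ω A B = record
  { states = states A × List (Σ _ (outTo A B))
  ; start  = (start A , [])
  ; inp    = λ { (inj₁ a) → inp A a ; (inj₂ a) → ⊥ }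
  ; out    = λ { (inj₁ a) → out A a ; (inj₂ a) → ⊥ }
  ; int    = λ { (inj₁ a) → int A a ; (inj₂ a) → outTo A B a }
  ; _⟶[_]_ = ΩStep A B
  }

_⊗as_ : ∀ {X} → IOTS X → IOTS X → IOTS (X ⊎ X)
A ⊗as B = Ω A B ⊗ Ω B A

-- Asynchronously composable: composable, and the fresh names do not clash
-- with act_A ∪ act_B (automatic under the tagging encoding above).
AsyncComposable : ∀ {X} → IOTS X → IOTS X → Set
AsyncComposable A B = Composable A B

HalfDuplex : ∀ {X} → IOTS X → IOTS X → Set
HalfDuplex A B = ∀ sA qA sB qB → Reach (A ⊗as B) ((sA , qA) , (sB , qB)) →
                 (qA ≡ []) ⊎ (qB ≡ [])

WeakSyncCompatible : ∀ {X} → IOTS X → IOTS X → Set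
WeakSyncCompatible C D =
  Composable C D ×
  (∀ sC sD → Reach (C ⊗ D) (sC , sD) →
     (∀ a sC' → out C a → inp D a → _⟶[_]_ C sC a sC' →
        ∃[ s̄D ] ∃[ sD' ] (IntStar D sD s̄D × _⟶[_]_ D s̄D a sD')) ×
     (∀ a sD' → out D a → inp C a → _⟶[_]_ D sD a sD' →
        ∃[ s̄C ] ∃[ sC' ] (IntStar C sC s̄C × _⟶[_]_ C s̄C a sC')))

WeakAsyncCompatible : ∀ {X} → IOTS X → IOTS X → Set
WeakAsyncCompatible A B = WeakSyncCompatible (Ω A B) (Ω B A)

-- Under half-duplex, asynchrony only lets one party run ahead: every reachable
-- asynchronous state is obtained from a reachable synchronous state by letting one
-- party take its non-shared steps and its sends, buffered in its queue, while the
-- other queue is empty.  In particular the reachable asynchronous states with empty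
-- queues are exactly the reachable synchronous states.  Weak compatibility makes
-- every pending message receivable after internal steps of the receiver, so an
-- asynchronous deadlock has empty queues; and at a synchronous deadlock a send
-- would have to be received either at once (a synchronous handshake), after an
-- internal step (a synchronous step), or after a send of the receiver (violating
-- half-duplex).  So deadlocks of the two systems correspond at empty queues.
module Submission where

open import Defs
open import Function.Base using (_∘_)
open import Function.Bundles using (_⇔_; mk⇔)
open import Data.Product.Base using (Σ; ∃-syntax; _×_; _,_; proj₁; proj₂; swap)
open import Data.Sum.Base using (_⊎_; inj₁; inj₂)
import Data.Sum.Base as Sum
open import Data.Empty using (⊥-elim)
open import Data.List.Base using (List; []; _∷_; _++_; [_])
open import Relation.Nullary using (¬_)

variable
  X Y : Set
  A B : IOTS X
  C D : IOTS Y

Stuck : (C : IOTS Y) → states C → Set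
Stuck C s = ∀ a s' → ¬ _⟶[_]_ C s a s'

send-step : ∀ {s s' q u a} → _⟶[_]_ A s a s' → (p : outTo A B a) →
            _⟶[_]_ (A ⊗as B) ((s , q) , u) (inj₂ a) ((s' , q ++ [ (a , p) ]) , u)
send-step x p = stepA (enq x p) λ { (inj₁ (() , _)) ; (inj₂ (() , _)) }

step-swap : ∀ {s s' t t' a} → SyncStep C D (s , t) a (s' , t') → SyncStep D C (t , s) a (t' , s')
step-swap (stepA x ns)    = stepB x (ns ∘ Sum.swap)
step-swap (stepB y ns)    = stepA y (ns ∘ Sum.swap)
step-swap (stepAB sh x y) = stepAB (Sum.swap sh) y x

reach-swap : ∀ {s t} → Reach (C ⊗ D) (s , t) → Reach (D ⊗ C) (t , s)
reach-swap reach-start       = reach-start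
reach-swap (reach-step R st) = reach-step (reach-swap R) (step-swap st)

stuck-swap : ∀ {s t} → Stuck (C ⊗ D) (s , t) → Stuck (D ⊗ C) (t , s)
stuck-swap stuck a (t' , s') st = stuck a (s' , t') (step-swap st)

weak-sync-compatible-swap : WeakSyncCompatible C D → WeakSyncCompatible D C
weak-sync-compatible-swap (comp , recv) =
  (λ a x y → Sum.swap (comp a y x)) , λ sD sC R → swap (recv sC sD (reach-swap R))

half-duplex-swap : HalfDuplex A B → HalfDuplex B A
half-duplex-swap hd sB qB sA qA R = Sum.swap (hd sA qA sB qB (reach-swap R))

half-duplex-violated : HalfDuplex A B → ∀ {sA sB m n qA qB} →
  ¬ Reach (A ⊗as B) ((sA , m ∷ qA) , (sB , n ∷ qB))
half-duplex-violated hd R with hd _ _ _ _ R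
... | inj₁ ()
... | inj₂ ()

Queue : (A B : IOTS X) → Set
Queue {X} A B = List (Σ X (outTo A B))

data Run (A B : IOTS X) : states A → Queue A B → states A → Set where
  done  : ∀ {s} → Run A B s [] s
  local : ∀ {t t' q s a} → _⟶[_]_ A t a t' → ¬ shared A B a → Run A B t' q s → Run A B t q s
  send  : ∀ {t t' q s a} → _⟶[_]_ A t a t' → (p : outTo A B a) → Run A B t' q s →
          Run A B t ((a , p) ∷ q) s

run-snoc-local : ∀ {t q s s' a} → Run A B t q s → _⟶[_]_ A s a s' → ¬ shared A B a →
                 Run A B t q s'
run-snoc-local done          x ns = local x ns done
run-snoc-local (local y m P) x ns = local y m (run-snoc-local P x ns)
run-snoc-local (send y p P)  x ns = send y p (run-snoc-local P x ns)

run-snoc-send : ∀ {t q s s' a} → Run A B t q s → _⟶[_]_ A s a s' → (p : outTo A B a) →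
                Run A B t (q ++ [ (a , p) ]) s'
run-snoc-send done          x p = send x p done
run-snoc-send (local y m P) x p = local y m (run-snoc-send P x p)
run-snoc-send (send y p' P) x p = send y p' (run-snoc-send P x p)

reach-run : ∀ {t u s} → Reach (A ⊗ B) (t , u) → Run A B t [] s → Reach (A ⊗ B) (s , u)
reach-run R done          = R
reach-run R (local x m P) = reach-run (reach-step R (stepA x m)) P

-- B receiving the first message sent along the run is A's send synchronised with it.
reach-deliver : ∀ {t u u' q s a} {p : outTo A B a} → Reach (A ⊗ B) (t , u) →
                Run A B t ((a , p) ∷ q) s → _⟶[_]_ B u a u' →
                ∃[ t' ] (Reach (A ⊗ B) (t' , u') × Run A B t' q s)
reach-deliver R (local x m P) y = reach-deliver (reach-step R (stepA x m)) P y
reach-deliver R (send x p P)  y = _ , reach-step R (stepAB (inj₂ (swap p)) x y) , P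

data Ahead (A B : IOTS X) : states (A ⊗as B) → Set where
  ahead : ∀ {tA sA qA sB} → Reach (A ⊗ B) (tA , sB) → Run A B tA qA sA →
          Ahead A B ((sA , qA) , (sB , []))

OneAhead : (A B : IOTS X) → states (A ⊗as B) → Set
OneAhead A B S = Ahead A B S ⊎ Ahead B A (swap S)

ahead-step : HalfDuplex A B → ∀ {S c S'} → Reach (A ⊗as B) S' → Ahead A B S →
             _⟶[_]_ (A ⊗as B) S c S' → OneAhead A B S'
ahead-step _ _ (ahead R P) (stepA (loc x _) ns) = inj₁ (ahead R (run-snoc-local P x ns))
ahead-step _ _ (ahead R P) (stepA (enq x p) _)  = inj₁ (ahead R (run-snoc-send P x p))
ahead-step _ _ _           (stepA (deq p) ns)   = ⊥-elim (ns (inj₂ (swap p)))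
ahead-step _ _ (ahead R P) (stepB (loc y _) ns) = inj₁ (ahead (reach-step R (stepB y ns)) P)
ahead-step _  _  (ahead {qA = []} R P)    (stepB (enq y p) _) =
  inj₂ (ahead (reach-swap (reach-run R P)) (send y p done))
ahead-step hd R' (ahead {qA = _ ∷ _} _ _) (stepB (enq _ _) _) = ⊥-elim (half-duplex-violated hd R')
ahead-step _ _ (ahead R P) (stepAB _ (deq _) (loc y _)) with reach-deliver R P y
... | _ , R'' , P' = inj₁ (ahead R'' P')
ahead-step _ _ _ (stepAB (inj₁ (i , o)) (loc _ _) (loc _ ny)) = ⊥-elim (ny (o , i))
ahead-step _ _ _ (stepAB (inj₂ (i , o)) (loc _ nx) (loc _ _)) = ⊥-elim (nx (o , i))
ahead-step _ _ _ (stepAB (inj₁ (() , _)) (enq _ _) (enq _ _))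
ahead-step _ _ _ (stepAB (inj₂ (() , _)) (enq _ _) (enq _ _))

one-ahead-step : HalfDuplex A B → ∀ {S c S'} → Reach (A ⊗as B) S' → OneAhead A B S →
                 _⟶[_]_ (A ⊗as B) S c S' → OneAhead A B S'
one-ahead-step hd R' (inj₁ h) st = ahead-step hd R' h st
one-ahead-step hd R' (inj₂ h) st =
  Sum.swap (ahead-step (half-duplex-swap hd) (reach-swap R') h (step-swap st))

reach⇒one-ahead : HalfDuplex A B → ∀ {S} → Reach (A ⊗as B) S → OneAhead A B S
reach⇒one-ahead _  reach-start       = inj₁ (ahead reach-start done)
reach⇒one-ahead hd (reach-step R st) =
  one-ahead-step hd (reach-step R st) (reach⇒one-ahead hd R) st

async-reach⇒sync-reach : HalfDuplex A B → ∀ {s t} →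
  Reach (A ⊗as B) ((s , []) , (t , [])) → Reach (A ⊗ B) (s , t)
async-reach⇒sync-reach hd R with reach⇒one-ahead hd R
... | inj₁ (ahead R' P) = reach-run R' P
... | inj₂ (ahead R' P) = reach-swap (reach-run R' P)

reach-handshake : IsIOTS B → ∀ {s s' t t' a} → Reach (A ⊗as B) ((s , []) , (t , [])) →
  _⟶[_]_ A s a s' → _⟶[_]_ B t a t' → outTo A B a → Reach (A ⊗as B) ((s' , []) , (t' , []))
reach-handshake wfB R x y p@(_ , i) =
  reach-step (reach-step R (send-step x p))
             (stepAB (inj₂ (swap p)) (deq p) (loc y (IsIOTS.in-out wfB _ i ∘ proj₁)))

sync-reach⇒async-reach : IsIOTS A → IsIOTS B → ∀ {s t} →
  Reach (A ⊗ B) (s , t) → Reach (A ⊗as B) ((s , []) , (t , []))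
sync-reach⇒async-reach _ _ reach-start = reach-start
sync-reach⇒async-reach wfA wfB (reach-step R (stepA x ns)) =
  reach-step (sync-reach⇒async-reach wfA wfB R) (stepA (loc x (ns ∘ inj₂ ∘ swap)) ns)
sync-reach⇒async-reach wfA wfB (reach-step R (stepB y ns)) =
  reach-step (sync-reach⇒async-reach wfA wfB R) (stepB (loc y (ns ∘ inj₁ ∘ swap)) ns)
sync-reach⇒async-reach wfA wfB (reach-step R (stepAB (inj₂ (i , o)) x y)) =
  reach-handshake wfB (sync-reach⇒async-reach wfA wfB R) x y (o , i)
sync-reach⇒async-reach wfA wfB (reach-step R (stepAB (inj₁ (i , o)) x y)) =
  reach-swap (reach-handshake wfA (reach-swap (sync-reach⇒async-reach wfA wfB R)) y x (o , i))

int-unshared : IsIOTS B → ∀ {c} → int (Ω B A) c → ¬ shared (Ω A B) (Ω B A) c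
int-unshared wfB {inj₁ c} ic (inj₁ (_ , o)) = IsIOTS.out-int wfB c o ic
int-unshared wfB {inj₁ c} ic (inj₂ (i , _)) = IsIOTS.in-int wfB c i ic
int-unshared _   {inj₂ _} _  (inj₁ (() , _))
int-unshared _   {inj₂ _} _  (inj₂ (() , _))

head-receivable : WeakAsyncCompatible A B → ∀ {sA a p q sB qB} →
  Reach (A ⊗as B) ((sA , (a , p) ∷ q) , (sB , qB)) →
  ∃[ s̄B ] ∃[ sB' ] (IntStar (Ω B A) (sB , qB) s̄B × _⟶[_]_ (Ω B A) s̄B (inj₁ a) sB')
head-receivable (_ , recv) {p = p} R = proj₁ (recv _ _ R) _ _ (proj₁ p) (proj₂ p) (deq p)

pending⇒¬stuck : IsIOTS B → WeakAsyncCompatible A B → ∀ {sA m q sB qB} →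
  Reach (A ⊗as B) ((sA , m ∷ q) , (sB , qB)) → ¬ Stuck (A ⊗as B) ((sA , m ∷ q) , (sB , qB))
pending⇒¬stuck wfB wc {m = _ , p} R stuck with head-receivable wc R
... | _ , _ , int-refl , y                    = stuck _ _ (stepAB (inj₂ (swap p)) (deq p) y)
... | _ , _ , int-step {a = c} ic y _ , _ = stuck _ _ (stepB y (int-unshared wfB {c} ic))

stuck⇒send-unreachable : IsIOTS B → WeakAsyncCompatible A B → HalfDuplex A B →
  ∀ {s s' t a} {p : outTo A B a} → Stuck (A ⊗ B) (s , t) → _⟶[_]_ A s a s' →
  ¬ Reach (A ⊗as B) ((s' , [ (a , p) ]) , (t , []))
stuck⇒send-unreachable {A = A} wfB wc hd {p = p} stuck x R with head-receivable wc R
... | _ , _ , int-refl , loc y _ = stuck _ _ (stepAB (inj₂ (swap p)) x y)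
... | _ , _ , int-step {a = c} ic (loc y _) _ , _ =
  stuck _ _ (stepB y (int-unshared {A = A} wfB {c} ic))
... | _ , _ , int-step _ (enq y p') _ , _ =
  half-duplex-violated hd (reach-step R (step-swap (send-step y p')))

stuck-async⇒stuck-sync : ∀ {s t} → Stuck (A ⊗as B) ((s , []) , (t , [])) → Stuck (A ⊗ B) (s , t)
stuck-async⇒stuck-sync stuck _ _ (stepA x ns) = stuck _ _ (stepA (loc x (ns ∘ inj₂ ∘ swap)) ns)
stuck-async⇒stuck-sync stuck _ _ (stepB y ns) = stuck _ _ (stepB (loc y (ns ∘ inj₁ ∘ swap)) ns)
stuck-async⇒stuck-sync stuck _ _ (stepAB (inj₂ (i , o)) x _) = stuck _ _ (send-step x (o , i))
stuck-async⇒stuck-sync stuck _ _ (stepAB (inj₁ (i , o)) _ y) =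
  stuck _ _ (step-swap (send-step y (o , i)))

stuck-sync⇒stuck-async : IsIOTS A → IsIOTS B → WeakAsyncCompatible A B → HalfDuplex A B →
  ∀ {s t} → Reach (A ⊗ B) (s , t) → Stuck (A ⊗ B) (s , t) →
  Stuck (A ⊗as B) ((s , []) , (t , []))
stuck-sync⇒stuck-async _ _ _ _ _ stuck _ _ (stepA (loc x _) ns)            = stuck _ _ (stepA x ns)
stuck-sync⇒stuck-async _ _ _ _ _ stuck _ _ (stepB (loc y _) ns)            = stuck _ _ (stepB y ns)
stuck-sync⇒stuck-async _ _ _ _ _ stuck _ _ (stepAB sh (loc x _) (loc y _)) = stuck _ _ (stepAB sh x y)
stuck-sync⇒stuck-async wfA wfB wc hd R stuck _ _ st@(stepA (enq x _) _) =
  stuck⇒send-unreachable wfB wc hd stuck x (reach-step (sync-reach⇒async-reach wfA wfB R) st)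
stuck-sync⇒stuck-async wfA wfB wc hd R stuck _ _ st@(stepB (enq y _) _) =
  stuck⇒send-unreachable wfA (weak-sync-compatible-swap wc) (half-duplex-swap hd)
    (stuck-swap stuck) y (reach-swap (reach-step (sync-reach⇒async-reach wfA wfB R) st))
stuck-sync⇒stuck-async _ _ _ _ _ _ _ _ (stepAB (inj₁ (() , _)) (enq _ _) _)
stuck-sync⇒stuck-async _ _ _ _ _ _ _ _ (stepAB (inj₂ (() , _)) (enq _ _) _)

sync⇒async-deadlock-free : IsIOTS A → IsIOTS B → WeakAsyncCompatible A B → HalfDuplex A B →
  DeadlockFree (A ⊗ B) → DeadlockFree (A ⊗as B)
sync⇒async-deadlock-free _ _ _ hd df ((s , []) , (t , [])) (R , stuck) =
  df (s , t) (async-reach⇒sync-reach hd R , stuck-async⇒stuck-sync stuck)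
sync⇒async-deadlock-free _ wfB wc _ _ ((_ , _ ∷ _) , _) (R , stuck) = pending⇒¬stuck wfB wc R stuck
sync⇒async-deadlock-free wfA _ wc _ _ ((_ , []) , (_ , _ ∷ _)) (R , stuck) =
  pending⇒¬stuck wfA (weak-sync-compatible-swap wc) (reach-swap R) (stuck-swap stuck)

async⇒sync-deadlock-free : IsIOTS A → IsIOTS B → WeakAsyncCompatible A B → HalfDuplex A B →
  DeadlockFree (A ⊗as B) → DeadlockFree (A ⊗ B)
async⇒sync-deadlock-free wfA wfB wc hd df (s , t) (R , stuck) =
  df ((s , []) , (t , []))
     (sync-reach⇒async-reach wfA wfB R , stuck-sync⇒stuck-async wfA wfB wc hd R stuck)

theorem6p3 : {X : Set} (A B : IOTS X) → IsIOTS A → IsIOTS B →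
    AsyncComposable A B → WeakAsyncCompatible A B → HalfDuplex A B →
    DeadlockFree (A ⊗ B) ⇔ DeadlockFree (A ⊗as B)
theorem6p3 A B wfA wfB _ wc hd =
  mk⇔ (sync⇒async-deadlock-free wfA wfB wc hd) (async⇒sync-deadlock-free wfA wfB wc hd)
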